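{- Consider inputs $(w,m)$, $w\in\Sigma^*$, $1\le m<\lvert w\rvert$, of the approximate string cover problem (specific version) with respect to the Hamming distance $d$, and the algorithm that outputs the tiling $\mathcal{I}=\{1,2,\dots,\lvert w\rvert-m+1\}$ together with $s'=\alpha^m$, where $\alpha\in\arg\max_\beta\mathrm{freq}_w(\beta)$. If $m\in\mathcal{O}(\sqrt{\lvert w\rvert})$, then this algorithm is an $\mathcal{O}(\sqrt{\lvert w\rvert})$ approximation, i.e. $\frac{\lvert w\rvert-d(w,w^*)}{\lvert w\rvert-d(w,\mathcal{I}(s'))}\in\mathcal{O}(\sqrt{\lvert w\rvert})$.
   Context: $\mathrm{freq}_w(\beta)$ is the number of occurrences of $\beta$ in $w$. A tiling of size $n$ is a set $\mathcal{I}=\{\mathcal{I}_1<\dots<\mathcal{I}_k\}\subseteq\{1,\dots,n\}$ with $\mathcal{I}_1=1$, norm $\lVert\mathcal{I}\rVert=n+1-\mathcal{I}_k$, and $\mathcal{I}_{i+1}-\mathcal{I}_i\le\lVert\mathcal{I}\rVert$. A word $s$ with $\lvert s\rvert=\lVert\mathcal{I}\rVert$ is valid for $\mathcal{I}$ if copies of $s$ placed starting at the positions $\mathcal{I}_i$ agree on all overlaps, and then $\mathcal{I}(s)$ is the resulting string of length $n$. The approximate string cover problem (specific version): given $w$ and $m<\lvert w\rvert$, find a tiling of size $\lvert w\rvert$ with norm $m$ and a valid $s$ minimizing $d(w,\mathcal{I}(s))$; $w^*$ denotes an optimal $\mathcal{I}(s)$. Cover efficiency: $\eta(w,w')=\frac{\lvert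 w\rvert-d(w,w')}{\lvert w\rvert-d(w,w^*)}$; an algorithm is an $\mathcal{O}(f(\lvert w\rvert))$ approximation iff $1/\eta\in\mathcal{O}(f(\lvert w\rvert))$. -}

module Defs where

open import Data.Nat using (ℕ; zero; suc; _+_; _*_; _∸_; _≤_; _<_)
open import Data.Fin using (Fin; toℕ)
import Data.Fin as F
open import Data.List using (List; []; _∷_; head; last; map; upTo)
open import Data.List.Membership.Propositional using (_∈_)
open import Data.Maybe using (Maybe; just)
open import Data.Unit using (⊤)
open import Data.Product using (_×_; ∃-syntax)
open import Relation.Binary.PropositionalEquality using (_≡_)
open import Relation.Binary.Definitions using (DecidableEquality)
open import Relation.Nullary using (yes; no)

-- Words of length n over Σ: functions Fin n → Σ.
-- Positions: the Fin index p corresponds to the paper's (1-indexed) position toℕ p + 1.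
Word : Set → ℕ → Set
Word Σ n = Fin n → Σ

module _ {Σ : Set} (_≟_ : DecidableEquality Σ) where

  hamming : ∀ {n} → Word Σ n → Word Σ n → ℕ
  hamming {zero}  u v = 0
  hamming {suc n} u v with u F.zero ≟ v F.zero
  ... | yes _ = hamming (λ i → u (F.suc i)) (λ i → v (F.suc i))
  ... | no  _ = suc (hamming (λ i → u (F.suc i)) (λ i → v (F.suc i)))

  freq : ∀ {n} → Σ → Word Σ n → ℕ
  freq {zero}  β w = 0
  freq {suc n} β w with w F.zero ≟ β
  ... | yes _ = suc (freq β (λ i → w (F.suc i)))
  ... | no  _ = freq β (λ i → w (F.suc i))

Gaps : ℕ → List ℕ → Set
Gaps m []           = ⊤
Gaps m (x ∷ [])     = ⊤
Gaps m (x ∷ y ∷ xs) = (x < y) × (y ≤ x + m) × Gaps m (y ∷ xs)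

-- A tiling of size n with norm m (positions 1-indexed, as in the paper):
-- strictly increasing list, first element 1, last element I_k with
-- n + 1 - I_k = m, consecutive gaps ≤ m.
IsTiling : ℕ → ℕ → List ℕ → Set
IsTiling n m I =
  (head I ≡ just 1) × (last I ≡ just (n + 1 ∸ m)) × (m ≤ n) × Gaps m I

-- s (|s| = m) is valid for I: copies of s placed at the (1-indexed)
-- positions of I agree on all overlaps. Copy starting at i puts s[k]
-- (k 0-indexed) at the 1-indexed position i + k.
Valid : ∀ {Σ : Set} {m} → List ℕ → Word Σ m → Set
Valid {m = m} I s = ∀ i j (k l : Fin m) → i ∈ I → j ∈ I →
  i + toℕ k ≡ j + toℕ l → s k ≡ s l

-- u is the string I(s) of length n: every position p of u covered by a
-- copy of s starting at i ∈ I carries the corresponding letter of s.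
-- (Paper position of p is toℕ p + 1.)
Realizes : ∀ {Σ : Set} {n m} → List ℕ → Word Σ m → Word Σ n → Set
Realizes {n = n} {m} I s u = ∀ (p : Fin n) i (k : Fin m) → i ∈ I →
  i + toℕ k ≡ toℕ p + 1 → u p ≡ s k

IsCover : ∀ {Σ : Set} → (n m : ℕ) → Word Σ n → Set
IsCover {Σ} n m u =
  ∃[ I ] ∃[ s ] (IsTiling n m I × Valid {Σ} {m} I s × Realizes I s u)

IsOptimal : ∀ {Σ : Set} → DecidableEquality Σ → ∀ {n} → ℕ → Word Σ n → Word Σ n → Set
IsOptimal _≟_ {n} m w wstar =
  IsCover n m wstar × (∀ u → IsCover n m u → hamming _≟_ w wstar ≤ hamming _≟_ w u)

IsMostFrequent : ∀ {Σ : Set} → DecidableEquality Σ → ∀ {n} → Σ → Word Σ n → Set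
IsMostFrequent _≟_ α w = ∀ β → freq _≟_ β w ≤ freq _≟_ α w

algTiling : ℕ → ℕ → List ℕ
algTiling n m = map suc (upTo (n + 1 ∸ m))

module Submission where

-- Write agree(u,v) = n ∸ hamming(u,v) for the number of
-- positions where two words of length n coincide, and F = freq_w(α) for the
-- largest letter frequency in w.
--   (1) Every position of a tiling of size n and norm m is covered by some
--       copy of s, so every letter of a cover I(s) is one of the m letters of
--       s.  The same holds for the algorithm's tiling {1, …, n-m+1}; with
--       s' = α^m its output is therefore the constant word α.
--   (2) A word all of whose letters lie in a list L agrees with w in at most
--       Σ_{β ∈ L} freq_w(β) ≤ |L| · F positions, and the constant word α
--       agrees with w in exactly F positions.
-- Hence agree(w,w*) ≤ m · F = m · agree(w,I(s')) for ANY cover w*, and squaring with m² ≤ C² n gives the theorem with K = C.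

open import Defs
open import Data.Nat using (ℕ; _+_; _*_; _∸_; _≤_; _<_)
open import Data.Product using (∃-syntax)
open import Relation.Binary.Definitions using (DecidableEquality)

open import Data.Nat using (zero; suc; z≤n; s≤s; _<?_; _⊓_)
open import Data.Nat.Properties
open import Data.Fin using (Fin; toℕ; fromℕ<)
import Data.Fin as F
open import Data.Fin.Properties using (toℕ-fromℕ<; toℕ<n)
open import Data.List using (List; []; _∷_; last; map; allFin; length)
open import Data.List.Properties using (length-map; length-tabulate)
open import Data.List.Membership.Propositional using (_∈_)
open import Data.List.Membership.Propositional.Properties
  using (∈-upTo⁺; ∈-allFin; ∈-map⁺; ∈-map⁻)
open import Data.List.Relation.Unary.Any using (here; there)
open import Data.Maybe using (just)
open import Data.Product using (_×_; _,_; Σ-syntax)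
open import Data.Sum using (inj₁; inj₂)
open import Relation.Binary.PropositionalEquality
open import Relation.Nullary using (yes; no)
open import Data.Empty using (⊥-elim)
open import Algebra.Properties.CommutativeSemigroup +-commutativeSemigroup
  using () renaming (interchange to +-interchange)
open import Algebra.Properties.CommutativeSemigroup *-commutativeSemigroup
  using () renaming (interchange to *-interchange)

Covers : ℕ → List ℕ → ℕ → Set
Covers m I q = Σ[ i ∈ ℕ ] (i ∈ I × i ≤ q × q < i + m)

offset : ∀ {m i q} → i ≤ q → q < i + m → Σ[ k ∈ Fin m ] (i + toℕ k ≡ q)
offset {m} {i} {q} i≤q q<i+m =
  fromℕ< q∸i<m , trans (cong (i +_) (toℕ-fromℕ< q∸i<m)) (m+[n∸m]≡n i≤q)
  where
  q∸i<m : q ∸ i < m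
  q∸i<m = subst (q ∸ i <_) (m+n∸m≡n i m) (∸-monoˡ-< q<i+m i≤q)

-- Copies with gaps at most m starting at x cover every q between x and the
-- end e + m of the last copy: skip copies ending before q; the next start is
-- then at most (previous start) + m ≤ q, so the invariant x ≤ q persists.
gaps-cover : ∀ {m q x e} xs → Gaps m (x ∷ xs) → last (x ∷ xs) ≡ just e →
             x ≤ q → q < e + m → Covers m (x ∷ xs) q
gaps-cover {m} {q} {x} xs gaps lastI x≤q q<e+m with q <? x + m
... | yes q<x+m = x , here refl , x≤q , q<x+m
gaps-cover [] _ refl _ q<e+m | no q≮x+m = ⊥-elim (q≮x+m q<e+m)
gaps-cover (y ∷ ys) (_ , y≤x+m , gaps) lastI _ q<e+m | no q≮x+m
  with gaps-cover ys gaps lastI (≤-trans y≤x+m (≮⇒≥ q≮x+m)) q<e+m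
... | i , i∈ , i≤q , q<i+m = i , there i∈ , i≤q , q<i+m

tiling-covers : ∀ {n m I} → IsTiling n m I → ∀ (p : Fin n) → Covers m I (toℕ p + 1)
tiling-covers {n} {m} {[]} (() , _)
tiling-covers {n} {m} {x ∷ xs} (refl , lastI , m≤n , gaps) p =
  gaps-cover xs gaps lastI (m≤n+m 1 (toℕ p)) q<end
  where
  q<end : toℕ p + 1 < n + 1 ∸ m + m
  q<end = subst (toℕ p + 1 <_) (sym (m∸n+n≡m (≤-trans m≤n (m≤m+n n 1))))
                (+-monoˡ-< 1 (toℕ<n p))

-- The algorithm's tiling {1, …, n-m+1} covers every position: position p+1
-- is covered by the copy starting at min(p, n-m) + 1.
algTiling-covers : ∀ {n m} → 1 ≤ m → m ≤ n → ∀ (p : Fin n) →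
                   Covers m (algTiling n m) (toℕ p + 1)
algTiling-covers {n} {m} 1≤m m≤n p =
  subst (Covers m (algTiling n m)) (+-comm 1 (toℕ p))
    (suc j , ∈-map⁺ suc (∈-upTo⁺ j<) , s≤s (m⊓n≤m (toℕ p) (n ∸ m)) , s≤s p<j+m)
  where
  j = toℕ p ⊓ (n ∸ m)
  j< : j < n + 1 ∸ m
  j< = subst (j <_) (sym (trans (+-∸-comm 1 m≤n) (+-comm (n ∸ m) 1)))
             (s≤s (m⊓n≤n (toℕ p) (n ∸ m)))
  p<j+m : toℕ p < j + m
  p<j+m with ≤-total (toℕ p) (n ∸ m)
  ... | inj₁ p≤n∸m rewrite m≤n⇒m⊓n≡m p≤n∸m = m<m+n (toℕ p) 1≤m
  ... | inj₂ n∸m≤p rewrite m≥n⇒m⊓n≡n n∸m≤p | m∸n+n≡m m≤n = toℕ<n p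

realized-letter : ∀ {Σ : Set} {n m I} {s : Word Σ m} {u : Word Σ n} →
  Realizes I s u → ∀ p → Covers m I (toℕ p + 1) → u p ∈ map s (allFin m)
realized-letter {m = m} {s = s} real p (i , i∈I , i≤q , q<i+m)
  with offset i≤q q<i+m
... | k , i+k≡q = subst (_∈ map s (allFin m)) (sym (real p i k i∈I i+k≡q))
                        (∈-map⁺ s (∈-allFin k))

cover-letters : ∀ {Σ : Set} {n m} {u : Word Σ n} → IsCover n m u →
  Σ[ L ∈ List Σ ] (length L ≡ m × ∀ p → u p ∈ L)
cover-letters {m = m} (I , s , tiling , _ , real) =
  map s (allFin m) ,
  trans (length-map s (allFin m)) (length-tabulate {n = m} (λ k → k)) ,
  λ p → realized-letter real p (tiling-covers tiling p)

algorithm-output : ∀ {Σ : Set} {n m} (α : Σ) {u : Word Σ n} → 1 ≤ m → m < n →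
  Realizes {m = m} (algTiling n m) (λ _ → α) u → ∀ p → u p ≡ α
algorithm-output {m = m} α 1≤m m<n real p
  with ∈-map⁻ (λ _ → α) (realized-letter real p (algTiling-covers 1≤m (<⇒≤ m<n) p))
... | _ , _ , up≡α = up≡α

module Counting {Σ : Set} (_≟_ : DecidableEquality Σ) where

  agree : ∀ {n} → Word Σ n → Word Σ n → ℕ
  agree {zero}  u v = 0
  agree {suc n} u v with u F.zero ≟ v F.zero
  ... | yes _ = suc (agree (λ i → u (F.suc i)) (λ i → v (F.suc i)))
  ... | no  _ = agree (λ i → u (F.suc i)) (λ i → v (F.suc i))

  hamming+agree : ∀ {n} (u v : Word Σ n) → hamming _≟_ u v + agree u v ≡ n
  hamming+agree {zero}  u v = refl
  hamming+agree {suc n} u v with u F.zero ≟ v F.zero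
  ... | yes _ = trans (+-suc _ _) (cong suc (hamming+agree _ _))
  ... | no  _ = cong suc (hamming+agree _ _)

  n∸hamming≡agree : ∀ {n} (u v : Word Σ n) → n ∸ hamming _≟_ u v ≡ agree u v
  n∸hamming≡agree {n} u v = begin
    n ∸ d                ≡⟨ cong (_∸ d) (hamming+agree u v) ⟨
    d + agree u v ∸ d    ≡⟨ m+n∸m≡n d (agree u v) ⟩
    agree u v            ∎
    where open ≡-Reasoning
          d = hamming _≟_ u v

  agree-constant : ∀ {n} (w v : Word Σ n) α → (∀ p → v p ≡ α) →
                   agree w v ≡ freq _≟_ α w
  agree-constant {zero}  w v α v≡α = refl
  agree-constant {suc n} w v α v≡α with w F.zero ≟ v F.zero | w F.zero ≟ α
  ... | yes _ | yes _ = cong suc (agree-constant _ _ α (λ p → v≡α (F.suc p)))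
  ... | no  _ | no  _ = agree-constant _ _ α (λ p → v≡α (F.suc p))
  ... | yes e | no ne = ⊥-elim (ne (trans e (v≡α F.zero)))
  ... | no ne | yes e = ⊥-elim (ne (trans e (sym (v≡α F.zero))))

  indicator : Σ → Σ → ℕ
  indicator x β with x ≟ β
  ... | yes _ = 1
  ... | no  _ = 0

  indicator-refl : ∀ x → indicator x x ≡ 1
  indicator-refl x with x ≟ x
  ... | yes _ = refl
  ... | no ne = ⊥-elim (ne refl)

  freq-head : ∀ {n} β (w : Word Σ (suc n)) →
    freq _≟_ β w ≡ indicator (w F.zero) β + freq _≟_ β (λ i → w (F.suc i))
  freq-head β w with w F.zero ≟ β
  ... | yes _ = refl
  ... | no  _ = refl

  freqSum : ∀ {n} → List Σ → Word Σ n → ℕ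
  freqSum []      w = 0
  freqSum (β ∷ L) w = freq _≟_ β w + freqSum L w

  multiplicity : Σ → List Σ → ℕ
  multiplicity x []      = 0
  multiplicity x (β ∷ L) = indicator x β + multiplicity x L

  multiplicity-pos : ∀ {x L} → x ∈ L → 1 ≤ multiplicity x L
  multiplicity-pos {x} (here refl) rewrite indicator-refl x = s≤s z≤n
  multiplicity-pos {L = _ ∷ _} (there x∈L) = ≤-trans (multiplicity-pos x∈L) (m≤n+m _ _)

  freqSum-head : ∀ {n} L (w : Word Σ (suc n)) →
    freqSum L w ≡ multiplicity (w F.zero) L + freqSum L (λ i → w (F.suc i))
  freqSum-head []      w = refl
  freqSum-head (β ∷ L) w = begin
    freq _≟_ β w + freqSum L w
      ≡⟨ cong₂ _+_ (freq-head β w) (freqSum-head L w) ⟩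
    (indicator x β + freq _≟_ β w') + (multiplicity x L + freqSum L w')
      ≡⟨ +-interchange (indicator x β) _ _ _ ⟩
    (indicator x β + multiplicity x L) + (freq _≟_ β w' + freqSum L w')   ∎
    where open ≡-Reasoning
          x  = w F.zero
          w' = λ i → w (F.suc i)

  agree≤freqSum : ∀ {n} (w v : Word Σ n) L → (∀ p → v p ∈ L) → agree w v ≤ freqSum L w
  agree≤freqSum {zero}  w v L v∈L = z≤n
  agree≤freqSum {suc n} w v L v∈L with w F.zero ≟ v F.zero
  ... | yes e rewrite freqSum-head L w =
        +-mono-≤ (multiplicity-pos (subst (_∈ L) (sym e) (v∈L F.zero)))
                 (agree≤freqSum _ _ L (λ p → v∈L (F.suc p)))
  ... | no  _ rewrite freqSum-head L w =
        ≤-trans (agree≤freqSum _ _ L (λ p → v∈L (F.suc p))) (m≤n+m _ _)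

  freqSum≤length*max : ∀ {n} (w : Word Σ n) {α} L → IsMostFrequent _≟_ α w →
                       freqSum L w ≤ length L * freq _≟_ α w
  freqSum≤length*max w []      αmax = z≤n
  freqSum≤length*max w (β ∷ L) αmax = +-mono-≤ (αmax β) (freqSum≤length*max w L αmax)

  cover-agree-bound : ∀ {n m} (w u : Word Σ n) {α} → IsMostFrequent _≟_ α w →
                      IsCover n m u → agree w u ≤ m * freq _≟_ α w
  cover-agree-bound w u αmax cover with cover-letters cover
  ... | L , refl , u∈L = ≤-trans (agree≤freqSum w u L u∈L) (freqSum≤length*max w L αmax)

  algorithm-approximation : ∀ {n m} (w wstar u' : Word Σ n) {α} → 1 ≤ m → m < n →
    IsMostFrequent _≟_ α w → Realizes {m = m} (algTiling n m) (λ _ → α) u' →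
    IsCover n m wstar → agree w wstar ≤ m * agree w u'
  algorithm-approximation w wstar u' {α} 1≤m m<n αmax real cover
    rewrite agree-constant w u' α (algorithm-output α 1≤m m<n real) =
    cover-agree-bound w wstar αmax cover

open Counting using (agree; n∸hamming≡agree; algorithm-approximation)

square-bound : ∀ {a b} m f → a ≤ m * f → m * m ≤ b → a * a ≤ b * (f * f)
square-bound {a} {b} m f a≤mf m²≤b = begin
  a * a               ≤⟨ *-mono-≤ a≤mf a≤mf ⟩
  (m * f) * (m * f)   ≡⟨ *-interchange m f m f ⟩
  (m * m) * (f * f)   ≤⟨ *-monoˡ-≤ (f * f) m²≤b ⟩
  b * (f * f)         ∎
  where open ≤-Reasoning

corollary2 : (Σ : Set) (_≟_ : DecidableEquality Σ) (C : ℕ) →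
    ∃[ K ] (∀ (n m : ℕ) (w : Word Σ n) → 1 ≤ m → m < n →
      m * m ≤ C * C * n →
      ∀ (α : Σ) → IsMostFrequent _≟_ α w →
      ∀ (u' : Word Σ n) → Realizes {m = m} (algTiling n m) (λ _ → α) u' →
      ∀ (wstar : Word Σ n) → IsOptimal _≟_ m w wstar →
      (n ∸ hamming _≟_ w wstar) * (n ∸ hamming _≟_ w wstar)
        ≤ K * K * n * ((n ∸ hamming _≟_ w u') * (n ∸ hamming _≟_ w u')))
corollary2 Σ _≟_ C =
  C , λ n m w 1≤m m<n m²≤C²n α αmax u' real wstar (wstar-cover , _) →
    subst₂ (λ a f → a * a ≤ C * C * n * (f * f))
      (sym (n∸hamming≡agree _≟_ w wstar)) (sym (n∸hamming≡agree _≟_ w u'))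
      (square-bound m (agree _≟_ w u')
        (algorithm-approximation _≟_ w wstar u' 1≤m m<n αmax real wstar-cover)
        m²≤C²n)
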